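{- Let $P=(E,\rho)$ be a $(q,m)$-polymatroid having at least one circuit. Then its girth satisfies $g(P)\le\lfloor\rho(E)/m\rfloor+1$.
   Context: $q$ prime power, $E=\mathbb F_q^n$, $\mathcal L(E)$ its subspaces. A $(q,m)$-polymatroid is $P=(E,\rho)$ with $\rho:\mathcal L(E)\to\mathbb Z_{\ge0}$ such that $0\le\rho(A)\le m\dim A$, $A\le B\Rightarrow\rho(A)\le\rho(B)$, and $\rho(A+B)+\rho(A\cap B)\le\rho(A)+\rho(B)$. A subspace $I$ is independent if $\rho(I)=m\dim I$, otherwise dependent; a circuit is a dependent subspace all of whose proper subspaces are independent. The girth $g(P)$ is the minimum dimension of a circuit ($\infty$ if there are none). -}

module Defs where

open import Level using (Level; 0ℓ)
open import Data.Nat using (ℕ; zero; suc; _*_; _≤_; _^_; _/_; NonZero)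
  renaming (_+_ to _+ℕ_)
open import Data.Nat.Primality using (Prime)
open import Data.Fin using (Fin) renaming (zero to fzero; suc to fsuc)
open import Data.Product using (Σ; Σ-syntax; ∃; ∃-syntax; _×_; _,_)
open import Data.Empty using (⊥)
open import Data.Unit using (⊤; tt)
open import Relation.Nullary using (¬_)
open import Relation.Binary.PropositionalEquality using (_≡_; _≢_; refl; sym; trans; cong; cong₂)
open import Algebra.Structures using (IsCommutativeRing)
open import Function.Bundles using (_↔_)

IsPrimePower : ℕ → Set
IsPrimePower q = Σ[ p ∈ ℕ ] Σ[ k ∈ ℕ ] (Prime p × 1 ≤ k × q ≡ p ^ k)

record FiniteField (q : ℕ) : Set₁ where
  field
    Carrier : Set
    _+_ _·_ : Carrier → Carrier → Carrier
    -_      : Carrier → Carrier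
    0# 1#   : Carrier
    isCommutativeRing : IsCommutativeRing _≡_ _+_ _·_ -_ 0# 1#
    0≢1     : 0# ≢ 1#
    inverse : (x : Carrier) → x ≢ 0# → Σ[ y ∈ Carrier ] (x · y ≡ 1#)
    enumeration : Carrier ↔ Fin q

module Space {q : ℕ} (F : FiniteField q) (n : ℕ) where
  open FiniteField F

  Vector : Set
  Vector = Fin n → Carrier

  zeroV : Vector
  zeroV _ = 0#

  _⊕_ : Vector → Vector → Vector
  (u ⊕ v) i = u i + v i

  _⊙_ : Carrier → Vector → Vector
  (c ⊙ v) i = c · v i

  lincomb : (d : ℕ) → (Fin d → Carrier) → (Fin d → Vector) → Vector
  lincomb zero    c v = zeroV
  lincomb (suc d) c v = (c fzero ⊙ v fzero) ⊕ lincomb d (λ i → c (fsuc i)) (λ i → v (fsuc i))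

  _≗_ : Vector → Vector → Set
  u ≗ v = ∀ i → u i ≡ v i

  record Subspace : Set₁ where
    field
      _∋_    : Vector → Set
      ∋-resp : ∀ {u v} → u ≗ v → _∋_ u → _∋_ v
      ∋-0    : _∋_ zeroV
      ∋-⊕    : ∀ {u v} → _∋_ u → _∋_ v → _∋_ (u ⊕ v)
      ∋-⊙    : ∀ c {v} → _∋_ v → _∋_ (c ⊙ v)
  open Subspace public

  _⊆_ : Subspace → Subspace → Set
  A ⊆ B = ∀ v → A ∋ v → B ∋ v

  full : Subspace
  full = record { _∋_ = λ _ → ⊤ ; ∋-resp = λ _ _ → tt ; ∋-0 = tt ; ∋-⊕ = λ _ _ → tt ; ∋-⊙ = λ _ _ → tt }

  _∩_ : Subspace → Subspace → Subspace
  A ∩ B = record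
    { _∋_ = λ v → A ∋ v × B ∋ v
    ; ∋-resp = λ e (a , b) → ∋-resp A e a , ∋-resp B e b
    ; ∋-0 = ∋-0 A , ∋-0 B
    ; ∋-⊕ = λ (a , b) (a' , b') → ∋-⊕ A a a' , ∋-⊕ B b b'
    ; ∋-⊙ = λ c (a , b) → ∋-⊙ A c a , ∋-⊙ B c b
    }

  private
    module R = IsCommutativeRing isCommutativeRing
    +-swap : ∀ a b a' b' → (a + b) + (a' + b') ≡ (a + a') + (b + b')
    +-swap a b a' b' =
      trans (R.+-assoc a b (a' + b'))
      (trans (cong (a +_) (trans (sym (R.+-assoc b a' b')) (trans (cong (_+ b') (R.+-comm b a')) (R.+-assoc a' b b'))))
      (sym (R.+-assoc a a' (b + b'))))

  _⊞_ : Subspace → Subspace → Subspace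
  A ⊞ B = record
    { _∋_ = λ v → Σ[ a ∈ Vector ] Σ[ b ∈ Vector ] (A ∋ a × B ∋ b × v ≗ (a ⊕ b))
    ; ∋-resp = λ e (a , b , ia , ib , eq) → a , b , ia , ib , (λ i → trans (sym (e i)) (eq i))
    ; ∋-0 = zeroV , zeroV , ∋-0 A , ∋-0 B , (λ i → sym (R.+-identityˡ 0#))
    ; ∋-⊕ = λ (a , b , ia , ib , eq) (a' , b' , ia' , ib' , eq') →
              (a ⊕ a') , (b ⊕ b') , ∋-⊕ A ia ia' , ∋-⊕ B ib ib'
              , (λ i → trans (cong₂ _+_ (eq i) (eq' i)) (+-swap (a i) (b i) (a' i) (b' i)))
    ; ∋-⊙ = λ c (a , b , ia , ib , eq) →
              (c ⊙ a) , (c ⊙ b) , ∋-⊙ A c ia , ∋-⊙ B c ib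
              , (λ i → trans (cong (c ·_) (eq i)) (R.distribˡ c (a i) (b i)))
    }

  record IsBasis (A : Subspace) (d : ℕ) (b : Fin d → Vector) : Set where
    field
      inA      : ∀ i → A ∋ b i
      linIndep : ∀ (c : Fin d → Carrier) → lincomb d c b ≗ zeroV → ∀ i → c i ≡ 0#
      spans    : ∀ v → A ∋ v → Σ[ c ∈ (Fin d → Carrier) ] (v ≗ lincomb d c b)

  HasDim : Subspace → ℕ → Set
  HasDim A d = Σ[ b ∈ (Fin d → Vector) ] IsBasis A d b

record Polymatroid {q : ℕ} (F : FiniteField q) (n m : ℕ) : Set₁ where
  open Space F n
  field
    ρ        : Subspace → ℕ
    ρ-bound  : ∀ A d → HasDim A d → ρ A ≤ m * d
    ρ-mono   : ∀ A B → A ⊆ B → ρ A ≤ ρ B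
    ρ-submod : ∀ A B → ρ (A ⊞ B) +ℕ ρ (A ∩ B) ≤ ρ A +ℕ ρ B

module _ {q : ℕ} {F : FiniteField q} {n m : ℕ} (P : Polymatroid F n m) where
  open Space F n
  open Polymatroid P

  Independent : Subspace → Set
  Independent I = Σ[ d ∈ ℕ ] (HasDim I d × ρ I ≡ m * d)

  Dependent : Subspace → Set
  Dependent I = ¬ Independent I

  _⊂_ : Subspace → Subspace → Set
  A ⊂ C = A ⊆ C × ¬ (C ⊆ A)

  Circuit : Subspace → Set₁
  Circuit C = Dependent C × (∀ A → A ⊂ C → Independent A)

{-# OPTIONS --safe #-}
-- A hyperplane H of a circuit C is a proper subspace, hence independent, so
-- m · (dim C − 1) = ρ(H) ≤ ρ(E).  Constructively one must first show that C has a dimension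
-- at all.  If P has a loop (a line ⟨v⟩ with ρ⟨v⟩ < m), that line is a circuit of dimension 1.
-- Otherwise a dependent C lies in no line, so C ∩ ⟨v⟩ is a proper, hence independent,
-- subspace of C whose dimension decides whether v ∈ C; membership being decidable, a basis
-- of C is found greedily by running through the q^n vectors of E.  Dimensions are compared
-- by counting: k independent vectors in a space with a d-element basis induce an injection
-- F^k → F^d, so q^k ≤ q^d.
module Submission where

open import Defs
open import Data.Nat using (ℕ; _≤_; _+_; _/_; NonZero)
open import Data.Product using (Σ-syntax; _×_)

open import Level using (0ℓ)
open import Function using (_∘_; id; const)
open import Data.Nat using (zero; suc; _*_; _^_; _<_; z≤n; s≤s)
import Data.Nat.Properties as ℕ
open import Data.Nat.DivMod using (m*n/n≡m; /-monoˡ-≤)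
open import Data.Fin using (Fin; combine; funToFin; finToFun) renaming (zero to fzero; suc to fsuc)
import Data.Fin.Properties as Fin
open import Data.Vec.Functional using (head; tail; map; zipWith) renaming (_∷_ to _◂_)
open import Data.Product using (∃; _,_; proj₁; proj₂)
open import Data.Sum using (_⊎_; inj₁; inj₂; [_,_]′)
open import Data.Unit using (tt)
open import Relation.Nullary using (¬_; Dec; yes; no; ¬?; contradiction)
open import Relation.Nullary.Decidable using (map′; via-injection; _×-dec_)
open import Relation.Binary.Definitions using (DecidableEquality)
open import Relation.Binary.PropositionalEquality
  using (_≡_; _≢_; _≗_; refl; sym; trans; cong; cong₂; subst; module ≡-Reasoning)
open import Algebra.Bundles using (Ring)
open import Algebra.Structures using (IsCommutativeRing)
open import Function.Bundles using (Injection; Inverse)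
open import Function.Properties.Inverse using (↔⇒↣)

funToFin-cong : ∀ {k l} {f g : Fin k → Fin l} → f ≗ g → funToFin f ≡ funToFin g
funToFin-cong {zero}  _   = refl
funToFin-cong {suc k} f≗g = cong₂ combine (f≗g fzero) (funToFin-cong (f≗g ∘ fsuc))

^-cancelʳ-≤ : ∀ b {k d} → 1 < b → b ^ k ≤ b ^ d → k ≤ d
^-cancelʳ-≤ b 1<b bᵏ≤bᵈ = ℕ.≮⇒≥ (λ d<k → ℕ.<⇒≱ (ℕ.^-monoʳ-< b 1<b d<k) bᵏ≤bᵈ)

distinct⇒1< : ∀ {k} (i j : Fin k) → i ≢ j → 1 < k
distinct⇒1< {suc zero}    fzero fzero i≢j = contradiction refl i≢j
distinct⇒1< {suc (suc k)} _     _     _   = s≤s (s≤s z≤n)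

m*n≤o⇒n≤o/m : ∀ m {n o} .{{_ : NonZero m}} → m * n ≤ o → n ≤ o / m
m*n≤o⇒n≤o/m m {n} {o} m*n≤o = begin
  n          ≡⟨ m*n/n≡m n m ⟨
  n * m / m  ≡⟨ cong (_/ m) (ℕ.*-comm n m) ⟩
  m * n / m  ≤⟨ /-monoˡ-≤ m m*n≤o ⟩
  o / m      ∎
  where open ℕ.≤-Reasoning

module FiniteFieldProperties {q : ℕ} (F : FiniteField q) where
  open FiniteField F renaming (_+_ to infixl 6 _+ᶠ_; _·_ to infixl 7 _·_; -_ to infix 8 -_)
  open IsCommutativeRing isCommutativeRing using (*-assoc; *-comm; *-identityˡ; zeroˡ; +-identityˡ)
  open ≡-Reasoning
  private
    module Enum = Inverse enumeration

  ring : Ring 0ℓ 0ℓ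
  ring = record { isRing = IsCommutativeRing.isRing isCommutativeRing }

  _≟_ : DecidableEquality Carrier
  _≟_ = via-injection (↔⇒↣ enumeration) Fin._≟_

  0·x+y≡y : ∀ x y → 0# · x +ᶠ y ≡ y
  0·x+y≡y x y = trans (cong (_+ᶠ y) (zeroˡ x)) (+-identityˡ y)

  inverse-cancelˡ : ∀ {c y} x → c · y ≡ 1# → y · (c · x) ≡ x
  inverse-cancelˡ {c} {y} x c·y≡1 = begin
    y · (c · x)  ≡⟨ *-assoc y c x ⟨
    y · c · x    ≡⟨ cong (_· x) (trans (*-comm y c) c·y≡1) ⟩
    1# · x       ≡⟨ *-identityˡ x ⟩
    x            ∎

  1<q : 1 < q
  1<q = distinct⇒1< (Enum.to 0#) (Enum.to 1#) (0≢1 ∘ Injection.injective (↔⇒↣ enumeration))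

  encode : ∀ {k} → (Fin k → Carrier) → Fin (q ^ k)
  encode c = funToFin (Enum.to ∘ c)

  decode : ∀ {k} → Fin (q ^ k) → Fin k → Carrier
  decode {k} x = Enum.from ∘ finToFun {q} {k} x

  decode-encode : ∀ {k} (c : Fin k → Carrier) → decode (encode c) ≗ c
  decode-encode c j = trans (cong Enum.from (Fin.finToFun-funToFin (Enum.to ∘ c) j)) (Enum.strictlyInverseʳ (c j))

  encode-decode : ∀ {k} (x : Fin (q ^ k)) → encode {k} (decode x) ≡ x
  encode-decode {k} x =
    trans (funToFin-cong (Enum.strictlyInverseˡ ∘ finToFun {q} {k} x)) (Fin.funToFin-finToFin {k} {q} x)

  encode-injective : ∀ {k} {c c′ : Fin k → Carrier} → encode c ≡ encode c′ → c ≗ c′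
  encode-injective {c = c} {c′} e j =
    trans (sym (decode-encode c j)) (trans (cong (λ x → decode x j) e) (decode-encode c′ j))

  decode-injective : ∀ {k} {x y : Fin (q ^ k)} → decode {k} x ≗ decode y → x ≡ y
  decode-injective {k} {x} {y} e =
    trans (sym (encode-decode {k} x)) (trans (funToFin-cong (cong Enum.to ∘ e)) (encode-decode {k} y))

  any-function? : ∀ {k} {Q : (Fin k → Carrier) → Set} →
    (∀ {c c′} → c ≗ c′ → Q c → Q c′) → (∀ c → Dec (Q c)) → Dec (∃ Q)
  any-function? resp Q? = map′
    (λ (x , Q[x]) → decode x , Q[x])
    (λ (c , Q[c]) → encode c , resp (sym ∘ decode-encode c) Q[c])
    (Fin.any? (Q? ∘ decode))

  injection⇒≤ : ∀ {k d} (f : (Fin k → Carrier) → (Fin d → Carrier)) →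
    (∀ {c c′} → f c ≗ f c′ → c ≗ c′) → k ≤ d
  injection⇒≤ f f-injective =
    ^-cancelʳ-≤ q 1<q (Fin.injective⇒≤ (decode-injective ∘ f-injective ∘ encode-injective))

module LinearAlgebra {q : ℕ} (F : FiniteField q) (n : ℕ) where
  open FiniteField F renaming (_+_ to infixl 6 _+ᶠ_; _·_ to infixl 7 _·_; -_ to infix 8 -_)
  open IsCommutativeRing isCommutativeRing
    using (*-assoc; *-identityˡ; zeroʳ; distribˡ; distribʳ; +-identityˡ; +-identityʳ; -‿inverseʳ)
  open FiniteFieldProperties F
  open import Algebra.Properties.Ring ring using (-1*x≈-x; -‿distribˡ-*; -‿distribʳ-*; +-inverseˡ-unique; x∙y⁻¹≈ε⇒x≈y)
  open import Algebra.Properties.CommutativeSemigroup (Ring.+-commutativeSemigroup ring) using (interchange)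
  open Space F n hiding (_≗_)
  open ≡-Reasoning

  lincomb-zero : ∀ d b → lincomb d (λ _ → 0#) b ≗ zeroV
  lincomb-zero zero    b i = refl
  lincomb-zero (suc d) b i = trans (0·x+y≡y (b fzero i) _) (lincomb-zero d (tail b) i)

  lincomb-+ : ∀ d c c′ b → lincomb d (zipWith _+ᶠ_ c c′) b ≗ lincomb d c b ⊕ lincomb d c′ b
  lincomb-+ zero    c c′ b i = sym (+-identityˡ 0#)
  lincomb-+ (suc d) c c′ b i = trans
    (cong₂ _+ᶠ_ (distribʳ (b fzero i) (c fzero) (c′ fzero)) (lincomb-+ d (tail c) (tail c′) (tail b) i))
    (interchange _ _ _ _)

  lincomb-· : ∀ d a c b → lincomb d (map (a ·_) c) b ≗ a ⊙ lincomb d c b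
  lincomb-· zero    a c b i = sym (zeroʳ a)
  lincomb-· (suc d) a c b i = trans
    (cong₂ _+ᶠ_ (*-assoc a (c fzero) (b fzero i)) (lincomb-· d a (tail c) (tail b) i))
    (sym (distribˡ a _ _))

  lincomb-cong : ∀ d {c c′} b → c ≗ c′ → lincomb d c b ≗ lincomb d c′ b
  lincomb-cong zero    b c≗c′ i = refl
  lincomb-cong (suc d) b c≗c′ i =
    cong₂ _+ᶠ_ (cong (_· b fzero i) (c≗c′ fzero)) (lincomb-cong d (tail b) (c≗c′ ∘ fsuc) i)

  lincomb-0◂ : ∀ d c b → lincomb (suc d) (0# ◂ c) b ≗ lincomb d c (tail b)
  lincomb-0◂ d c b i = 0·x+y≡y (b fzero i) _

  lincomb-head : ∀ d b → lincomb (suc d) (1# ◂ λ _ → 0#) b ≗ head b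
  lincomb-head d b i = trans (cong₂ _+ᶠ_ (*-identityˡ _) (lincomb-zero d (tail b) i)) (+-identityʳ _)

  lincomb-∈ : ∀ (A : Subspace) d c b → (∀ j → A ∋ b j) → A ∋ lincomb d c b
  lincomb-∈ A zero    c b b∈A = ∋-0 A
  lincomb-∈ A (suc d) c b b∈A =
    ∋-⊕ A (∋-⊙ A (c fzero) (b∈A fzero)) (lincomb-∈ A d (tail c) (tail b) (b∈A ∘ fsuc))

  span : (d : ℕ) → (Fin d → Vector) → Subspace
  span d b = record
    { _∋_    = λ v → Σ[ c ∈ (Fin d → Carrier) ] (v ≗ lincomb d c b)
    ; ∋-resp = λ u≗v (c , u≗cb) → c , λ i → trans (sym (u≗v i)) (u≗cb i)
    ; ∋-0    = (λ _ → 0#) , sym ∘ lincomb-zero d b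
    ; ∋-⊕    = λ (c , u≗cb) (c′ , v≗c′b) → zipWith _+ᶠ_ c c′ ,
                 λ i → trans (cong₂ _+ᶠ_ (u≗cb i) (v≗c′b i)) (sym (lincomb-+ d c c′ b i))
    ; ∋-⊙    = λ a (c , v≗cb) → map (a ·_) c ,
                 λ i → trans (cong (a ·_) (v≗cb i)) (sym (lincomb-· d a c b i))
    }

  span-⊆ : ∀ A d b → (∀ j → A ∋ b j) → span d b ⊆ A
  span-⊆ A d b b∈A v (c , v≗cb) = ∋-resp A (sym ∘ v≗cb) (lincomb-∈ A d c b b∈A)

  ∈-span : ∀ d b j → span d b ∋ b j
  ∈-span (suc d) b fzero    = (1# ◂ λ _ → 0#) , sym ∘ lincomb-head d b
  ∈-span (suc d) b (fsuc j) =
    let c , bⱼ≗c = ∈-span d (tail b) j in (0# ◂ c) , λ i → trans (bⱼ≗c i) (sym (lincomb-0◂ d c b i))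

  line : Vector → Subspace
  line v = span 1 (λ _ → v)

  ∈-line : ∀ v → line v ∋ v
  ∈-line v = ∈-span 1 (λ _ → v) fzero

  line-⊆ : ∀ A v → A ∋ v → line v ⊆ A
  line-⊆ A v v∈A = span-⊆ A 1 (λ _ → v) (const v∈A)

  LinearlyIndependent : (d : ℕ) → (Fin d → Vector) → Set
  LinearlyIndependent d b = ∀ c → lincomb d c b ≗ zeroV → ∀ j → c j ≡ 0#

  LI-injective : ∀ {d b} → LinearlyIndependent d b → ∀ {c c′} → lincomb d c b ≗ lincomb d c′ b → c ≗ c′
  LI-injective {d} {b} li {c} {c′} cb≗c′b j =
    x∙y⁻¹≈ε⇒x≈y (c j) (c′ j) (trans (cong (c j +ᶠ_) (sym (-1*x≈-x (c′ j)))) (li _ difference-vanishes j))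
    where
    difference-vanishes : lincomb d (zipWith _+ᶠ_ c (map (- 1# ·_) c′)) b ≗ zeroV
    difference-vanishes i = begin
      lincomb d (zipWith _+ᶠ_ c (map (- 1# ·_) c′)) b i         ≡⟨ lincomb-+ d c _ b i ⟩
      lincomb d c b i +ᶠ lincomb d (map (- 1# ·_) c′) b i       ≡⟨ cong₂ _+ᶠ_ (cb≗c′b i) (lincomb-· d (- 1#) c′ b i) ⟩
      lincomb d c′ b i +ᶠ - 1# · lincomb d c′ b i               ≡⟨ cong (lincomb d c′ b i +ᶠ_) (-1*x≈-x _) ⟩
      lincomb d c′ b i +ᶠ - lincomb d c′ b i                    ≡⟨ -‿inverseʳ _ ⟩
      0#                                                        ∎

  LI-tail : ∀ {d b} → LinearlyIndependent (suc d) b → LinearlyIndependent d (tail b)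
  LI-tail {d} {b} li c c·tail≗0 j = li (0# ◂ c) (λ i → trans (lincomb-0◂ d c b i) (c·tail≗0 i)) (fsuc j)

  LI-head-nonzero : ∀ {d b} → LinearlyIndependent (suc d) b → ¬ head b ≗ zeroV
  LI-head-nonzero {d} {b} li head≗0 =
    0≢1 (sym (li (1# ◂ λ _ → 0#) (λ i → trans (lincomb-head d b i) (head≗0 i)) fzero))

  LI-head-∉-span-tail : ∀ {d b} → LinearlyIndependent (suc d) b → ¬ span d (tail b) ∋ head b
  LI-head-∉-span-tail {d} {b} li (c , head≗c) = 0≢1 (sym (li (1# ◂ map (- 1# ·_) c) vanishes fzero))
    where
    vanishes : lincomb (suc d) (1# ◂ map (- 1# ·_) c) b ≗ zeroV
    vanishes i = begin
      1# · head b i +ᶠ lincomb d (map (- 1# ·_) c) (tail b) i   ≡⟨ cong₂ _+ᶠ_ (trans (*-identityˡ _) (head≗c i)) (lincomb-· d (- 1#) c (tail b) i) ⟩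
      lincomb d c (tail b) i +ᶠ - 1# · lincomb d c (tail b) i   ≡⟨ cong (lincomb d c (tail b) i +ᶠ_) (-1*x≈-x _) ⟩
      lincomb d c (tail b) i +ᶠ - lincomb d c (tail b) i        ≡⟨ -‿inverseʳ _ ⟩
      0#                                                        ∎

  LI-◂ : ∀ {d b v} → LinearlyIndependent d b → ¬ span d b ∋ v → LinearlyIndependent (suc d) (v ◂ b)
  LI-◂ {d} {b} {v} li v∉span c c·vb≗0 with c fzero ≟ 0#
  ... | yes c₀≡0 = λ { fzero → c₀≡0 ; (fsuc j) → li (tail c) tail-vanishes j }
    where
    tail-vanishes : lincomb d (tail c) b ≗ zeroV
    tail-vanishes i = trans (sym (trans (cong (λ a → a · v i +ᶠ lincomb d (tail c) b i) c₀≡0) (0·x+y≡y _ _))) (c·vb≗0 i)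
  ... | no c₀≢0 = contradiction (v∈span (inverse (c fzero) c₀≢0)) v∉span
    where
    v∈span : Σ[ y ∈ Carrier ] (c fzero · y ≡ 1#) → span d b ∋ v
    v∈span (y , c₀·y≡1) = map (- y ·_) (tail c) , λ i → begin
      v i                                ≡⟨ inverse-cancelˡ (v i) c₀·y≡1 ⟨
      y · (c fzero · v i)                ≡⟨ cong (y ·_) (+-inverseˡ-unique _ _ (c·vb≗0 i)) ⟩
      y · - lincomb d (tail c) b i       ≡⟨ -‿distribʳ-* y _ ⟨
      - (y · lincomb d (tail c) b i)     ≡⟨ -‿distribˡ-* y _ ⟩
      - y · lincomb d (tail c) b i       ≡⟨ lincomb-· d (- y) (tail c) b i ⟨
      lincomb d (map (- y ·_) (tail c)) b i ∎

  -- lincomb 1 only inspects the head of the family, so this is LI-◂ for the empty family.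
  LI-line : ∀ {v} → ¬ v ≗ zeroV → LinearlyIndependent 1 (λ _ → v)
  LI-line {v} v≢0 = LI-◂ {b = λ ()} (λ _ _ ()) (v≢0 ∘ proj₂)

  span-HasDim : ∀ {d b} → LinearlyIndependent d b → HasDim (span d b) d
  span-HasDim {d} {b} li = b , record { inA = ∈-span d b ; linIndep = li ; spans = λ _ v∈span → v∈span }

  line-HasDim : ∀ {v} → ¬ v ≗ zeroV → HasDim (line v) 1
  line-HasDim {v} v≢0 = span-HasDim {b = λ _ → v} (LI-line v≢0)

  zero-HasDim-0 : ∀ {A} → (∀ w → A ∋ w → w ≗ zeroV) → HasDim A 0
  zero-HasDim-0 A≗0 = (λ ()) , record { inA = λ () ; linIndep = λ _ _ () ; spans = λ w w∈A → (λ ()) , A≗0 w w∈A }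

  HasDim-0⇒zero : ∀ {A} → HasDim A 0 → ∀ w → A ∋ w → w ≗ zeroV
  HasDim-0⇒zero (_ , basis) w w∈A = proj₂ (IsBasis.spans basis w w∈A)

  ⊆-line⇒zero⊎∋ : ∀ A v {w} → A ⊆ line v → A ∋ w → w ≗ zeroV ⊎ A ∋ v
  ⊆-line⇒zero⊎∋ A v {w} A⊆line w∈A with A⊆line w w∈A
  ... | c , w≗cv with c fzero ≟ 0#
  ...   | yes c₀≡0 = inj₁ λ i → trans (w≗cv i) (trans (cong (λ a → a · v i +ᶠ 0#) c₀≡0) (0·x+y≡y _ _))
  ...   | no c₀≢0 with inverse (c fzero) c₀≢0
  ...     | y , c₀·y≡1 = inj₂ (∋-resp A y·w≗v (∋-⊙ A y w∈A))
    where
    y·w≗v : y ⊙ w ≗ v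
    y·w≗v i = trans (cong (y ·_) (trans (w≗cv i) (+-identityʳ _))) (inverse-cancelˡ (v i) c₀·y≡1)

  LI-length≤dim : ∀ {A k d a} → (∀ j → A ∋ a j) → LinearlyIndependent k a → HasDim A d → k ≤ d
  LI-length≤dim {A} {k} {d} {a} a∈A li (b , basis) = injection⇒≤ coordinates coordinates-injective
    where
    open IsBasis basis
    coordinates : (Fin k → Carrier) → (Fin d → Carrier)
    coordinates c = proj₁ (spans (lincomb k c a) (lincomb-∈ A k c a a∈A))
    coordinates-spec : ∀ c → lincomb k c a ≗ lincomb d (coordinates c) b
    coordinates-spec c = proj₂ (spans (lincomb k c a) (lincomb-∈ A k c a a∈A))
    coordinates-injective : ∀ {c c′} → coordinates c ≗ coordinates c′ → c ≗ c′
    coordinates-injective {c} {c′} e = LI-injective li λ i →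
      trans (coordinates-spec c i) (trans (lincomb-cong d b e i) (sym (coordinates-spec c′ i)))

  _≗?_ : (u v : Vector) → Dec (u ≗ v)
  u ≗? v = Fin.all? (λ i → u i ≟ v i)

  ∈-span? : ∀ d b v → Dec (span d b ∋ v)
  ∈-span? d b v = any-function?
    (λ c≗c′ v≗cb i → trans (v≗cb i) (lincomb-cong d b c≗c′ i))
    (λ c → v ≗? lincomb d c b)

  record IndependentFamily (A : Subspace) : Set where
    field
      size        : ℕ
      vectors     : Fin size → Vector
      ⊆A          : ∀ j → A ∋ vectors j
      independent : LinearlyIndependent size vectors

  open IndependentFamily

  ⟨_⟩ : ∀ {A} → IndependentFamily A → Subspace
  ⟨ s ⟩ = span (size s) (vectors s)

  module _ (A : Subspace) (_∈A? : ∀ v → Dec (A ∋ v)) where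

    Covers : IndependentFamily A → Vector → Set
    Covers s x = A ∋ x → ⟨ s ⟩ ∋ x

    extend : (s : IndependentFamily A) {x : Vector} → A ∋ x → ¬ ⟨ s ⟩ ∋ x → IndependentFamily A
    extend s {x} x∈A x∉s = record
      { size        = suc (size s)
      ; vectors     = x ◂ vectors s
      ; ⊆A          = λ { fzero → x∈A ; (fsuc j) → ⊆A s j }
      ; independent = LI-◂ (independent s) x∉s
      }

    ⟨⟩-⊆-extend : ∀ s {x} (x∈A : A ∋ x) (x∉s : ¬ ⟨ s ⟩ ∋ x) → ⟨ s ⟩ ⊆ ⟨ extend s x∈A x∉s ⟩
    ⟨⟩-⊆-extend s {x} _ _ w (c , w≗cs) =
      (0# ◂ c) , λ i → trans (w≗cs i) (sym (lincomb-0◂ (size s) c (x ◂ vectors s) i))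

    absorb : (s : IndependentFamily A) (x : Vector) → Σ[ t ∈ IndependentFamily A ] (⟨ s ⟩ ⊆ ⟨ t ⟩ × Covers t x)
    absorb s x with ∈-span? (size s) (vectors s) x | x ∈A?
    ... | yes x∈s | _       = s , (λ _ w∈s → w∈s) , const x∈s
    ... | no _    | no x∉A  = s , (λ _ w∈s → w∈s) , λ x∈A → contradiction x∈A x∉A
    ... | no x∉s  | yes x∈A = extend s x∈A x∉s , ⟨⟩-⊆-extend s x∈A x∉s , const (∈-span (suc (size s)) (x ◂ vectors s) fzero)

    absorb-all : ∀ k (xs : Fin k → Vector) (s : IndependentFamily A) →
      Σ[ t ∈ IndependentFamily A ] (⟨ s ⟩ ⊆ ⟨ t ⟩ × (∀ j → Covers t (xs j)))
    absorb-all zero    xs s = s , (λ _ w∈s → w∈s) , λ ()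
    absorb-all (suc k) xs s =
      let t , s⊆t , t-covers-head = absorb s (head xs)
          u , t⊆u , u-covers-tail = absorb-all k (tail xs) t
      in u , (λ w → t⊆u w ∘ s⊆t w)
           , λ { fzero → t⊆u (head xs) ∘ t-covers-head ; (fsuc j) → u-covers-tail j }

    empty : IndependentFamily A
    empty = record { size = 0 ; vectors = λ () ; ⊆A = λ () ; independent = λ _ _ () }

    decidable⇒HasDim : Σ[ d ∈ ℕ ] HasDim A d
    decidable⇒HasDim =
      let s , _ , covers-all = absorb-all (q ^ n) decode empty
          spans : ∀ v → A ∋ v → ⟨ s ⟩ ∋ v
          spans v v∈A = ∋-resp ⟨ s ⟩ (decode-encode v)
            (covers-all (encode v) (∋-resp A (sym ∘ decode-encode v) v∈A))
      in size s , vectors s , record { inA = ⊆A s ; linIndep = independent s ; spans = spans }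

module PolymatroidProperties {q : ℕ} {F : FiniteField q} {n m : ℕ} (P : Polymatroid F n m) where
  open Space F n hiding (_≗_)
  open LinearAlgebra F n
  open FiniteFieldProperties F using (any-function?)
  open Polymatroid P

  zero-independent : ∀ {A} → (∀ w → A ∋ w → w ≗ zeroV) → Independent P A
  zero-independent {A} A≗0 = 0 , zero-HasDim-0 A≗0 ,
    ℕ.≤-antisym (ρ-bound A 0 (zero-HasDim-0 A≗0)) (subst (_≤ ρ A) (sym (ℕ.*-zeroʳ m)) z≤n)

  loop-circuit : ∀ {v} → ¬ v ≗ zeroV → ρ (line v) < m → Circuit P (line v)
  loop-circuit {v} v≢0 ρ<m = dependent , proper⇒independent
    where
    dependent : Dependent P (line v)
    dependent (zero  , dim-0 , _)   = v≢0 (HasDim-0⇒zero dim-0 v (∈-line v))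
    dependent (suc d , _ , ρ≡m*d) = ℕ.<⇒≱ ρ<m (subst (m ≤_) (sym ρ≡m*d) (ℕ.m≤m*n m (suc d)))
    proper⇒independent : ∀ A → _⊂_ P A (line v) → Independent P A
    proper⇒independent A (A⊆line , line⊈A) = zero-independent λ w w∈A →
      [ id , (λ v∈A → contradiction (line-⊆ A v v∈A) line⊈A) ]′ (⊆-line⇒zero⊎∋ A v A⊆line w∈A)

  Loopless : Set
  Loopless = ∀ v → ¬ v ≗ zeroV → m ≤ ρ (line v)

  loop⊎loopless : (Σ[ v ∈ Vector ] (¬ v ≗ zeroV × ρ (line v) < m)) ⊎ Loopless
  loop⊎loopless with any-function? resp (λ v → ¬? (v ≗? zeroV) ×-dec (ρ (line v) ℕ.<? m))
    where
    resp : ∀ {v v′} → v ≗ v′ → ¬ v ≗ zeroV × ρ (line v) < m → ¬ v′ ≗ zeroV × ρ (line v′) < m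
    resp {v} {v′} v≗v′ (v≢0 , ρ<m) =
      (λ v′≗0 → v≢0 λ i → trans (v≗v′ i) (v′≗0 i)) ,
      ℕ.≤-<-trans (ρ-mono _ _ (line-⊆ (line v) v′ (∋-resp (line v) v≗v′ (∈-line v)))) ρ<m
  ... | yes loop  = inj₁ loop
  ... | no ¬loop = inj₂ λ v v≢0 → ℕ.≮⇒≥ λ ρ<m → ¬loop (v , v≢0 , ρ<m)

  dependent-⊈-line : Loopless → ∀ {C} → Dependent P C → ∀ {v} → ¬ v ≗ zeroV → ¬ C ⊆ line v
  dependent-⊈-line loopless {C} C-dependent {v} v≢0 C⊆line = C-dependent (zero-independent C≗0)
    where
    ∋v⇒independent : C ∋ v → Independent P C
    ∋v⇒independent v∈C = 1 , C-dim , ℕ.≤-antisym (ρ-bound C 1 C-dim) (begin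
      m * 1      ≡⟨ ℕ.*-identityʳ m ⟩
      m          ≤⟨ loopless v v≢0 ⟩
      ρ (line v) ≤⟨ ρ-mono (line v) C (line-⊆ C v v∈C) ⟩
      ρ C        ∎)
      where
      open ℕ.≤-Reasoning
      C-dim : HasDim C 1
      C-dim = (λ _ → v) , record { inA = const v∈C ; linIndep = LI-line v≢0 ; spans = C⊆line }
    C≗0 : ∀ w → C ∋ w → w ≗ zeroV
    C≗0 w w∈C = [ id , (λ v∈C → contradiction (∋v⇒independent v∈C) C-dependent) ]′
      (⊆-line⇒zero⊎∋ C v C⊆line w∈C)

  circuit-∈? : Loopless → ∀ {C} → Circuit P C → ∀ v → Dec (C ∋ v)
  circuit-∈? loopless {C} (C-dependent , proper⇒independent) v with v ≗? zeroV
  ... | yes v≗0 = yes (∋-resp C (sym ∘ v≗0) (∋-0 C))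
  ... | no v≢0 with proper⇒independent (C ∩ line v) ((λ _ → proj₁) , C⊈C∩line)
    where
    C⊈C∩line : ¬ C ⊆ (C ∩ line v)
    C⊈C∩line C⊆C∩line = dependent-⊈-line loopless C-dependent v≢0 (λ w → proj₂ ∘ C⊆C∩line w)
  ...   | zero  , dim-0 , _ = no λ v∈C → v≢0 (HasDim-0⇒zero dim-0 v (v∈C , ∈-line v))
  ...   | suc d , (b , basis) , _ =
    [ (λ b₀≗0 → contradiction b₀≗0 (LI-head-nonzero {b = b} (IsBasis.linIndep basis))) , yes ∘ proj₁ ]′
      (⊆-line⇒zero⊎∋ (C ∩ line v) v (λ _ → proj₂) (IsBasis.inA basis fzero))

  circuit-HasDim : Loopless → ∀ {C} → Circuit P C → Σ[ d ∈ ℕ ] HasDim C d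
  circuit-HasDim loopless {C} circuit = decidable⇒HasDim C (circuit-∈? loopless circuit)

  circuit-hyperplane-rank : ∀ {C d} → Circuit P C → HasDim C (suc d) → m * d ≤ ρ full
  circuit-hyperplane-rank {C} {d} (_ , proper⇒independent) (b , basis) =
    bound (proper⇒independent H (span-⊆ C d (tail b) (inA ∘ fsuc) , C⊈H))
    where
    open IsBasis basis
    H : Subspace
    H = span d (tail b)
    C⊈H : ¬ C ⊆ H
    C⊈H C⊆H = LI-head-∉-span-tail {b = b} linIndep (C⊆H (b fzero) (inA fzero))
    bound : Independent P H → m * d ≤ ρ full
    bound (d′ , H-dim , ρH≡m*d′) = begin
      m * d  ≤⟨ ℕ.*-monoʳ-≤ m (LI-length≤dim (∈-span d (tail b)) (LI-tail {b = b} linIndep) H-dim) ⟩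
      m * d′ ≡⟨ ρH≡m*d′ ⟨
      ρ H    ≤⟨ ρ-mono H full (λ _ _ → tt) ⟩
      ρ full ∎
      where open ℕ.≤-Reasoning

  circuit-dim≤ : ∀ {C d} .{{_ : NonZero m}} → Circuit P C → HasDim C d → d ≤ ρ full / m + 1
  circuit-dim≤ {d = zero}  _       _     = z≤n
  circuit-dim≤ {d = suc d} circuit C-dim =
    subst (suc d ≤_) (ℕ.+-comm 1 (ρ full / m)) (s≤s (m*n≤o⇒n≤o/m m (circuit-hyperplane-rank circuit C-dim)))

proposition3p15 : {q : ℕ} → IsPrimePower q → (F : FiniteField q) (n m : ℕ) → .{{_ : NonZero m}}
    → (P : Polymatroid F n m)
    → Σ[ C ∈ Space.Subspace F n ] Circuit P C
    → Σ[ C ∈ Space.Subspace F n ] (Circuit P C × Σ[ d ∈ ℕ ] (Space.HasDim F n C d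
        × d ≤ Polymatroid.ρ P (Space.full F n) / m + 1))
proposition3p15 _ F n m P (C , circuit) with PolymatroidProperties.loop⊎loopless P
... | inj₁ (v , v≢0 , ρ<m) = line v , loop-circuit v≢0 ρ<m , 1 , line-HasDim v≢0 , ℕ.m≤n+m 1 _
  where
  open LinearAlgebra F n
  open PolymatroidProperties P
... | inj₂ loopless =
  let d , C-dim = circuit-HasDim loopless circuit in C , circuit , d , C-dim , circuit-dim≤ circuit C-dim
  where open PolymatroidProperties P
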